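{- Let $\Pi_{\rm odd}$ be the map on $\mathbb{N}=\{1,2,3,\dots\}$ produced by the following procedure. At step $1$ set $\Pi_{\rm odd}(1)=1$. For $m=2,3,4,\dots$ in turn, at step $m$: if $m$ is odd or $\Pi_{\rm odd}(m-\lfloor m/2\rfloor)$ has been assigned at an earlier step, set $\Pi_{\rm odd}(m+\lfloor m/2\rfloor)=m$; otherwise set $\Pi_{\rm odd}(m-\lfloor m/2\rfloor)=m$. Let $R_{\rm opos}(1)<R_{\rm opos}(2)<\cdots$ be the increasing enumeration of the record positions of $\Pi_{\rm odd}$ and $R_{\rm orec}(n)=\Pi_{\rm odd}(R_{\rm opos}(n))$. Let $\tau$ be the morphism on $\{1,2,3\}^*$ given by $\tau(1)=12$, $\tau(2)=312$, $\tau(3)=3312$, and let $t=t(1)t(2)\dots=1231233121\dots$ be its fixed point starting with $1$. Then for all $n\ge1$, $R_{\rm opos}(n+2)-R_{\rm opos}(n+1)=t(n+2)$ and $R_{\rm orec}(n+2)-R_{\rm orec}(n+1)=2\,t(n+2)$.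
   Context: The procedure assigns a value $\Pi_{\rm odd}(n)$ to every $n\in\mathbb{N}$. A position $n\ge1$ is a record position of $\Pi_{\rm odd}$ if $\Pi_{\rm odd}(n)>\Pi_{\rm odd}(m)$ for all $1\le m<n$ (so $1$ is a record position). (In the paper this is stated as $T(\Delta R_{\rm opos})=T^2(t)$ and $T(\Delta R_{\rm orec})=2T^2(t)$, with $T$ the shift and $\Delta$ the first-difference operator.) -}

module Defs where

open import Data.Nat using (ℕ; zero; suc; _+_; _*_; _∸_; _/_; _%_; _≡ᵇ_; _≤_; _<_)
open import Data.Bool using (Bool; true; false; _∨_; if_then_else_)
open import Data.List using (List; []; _∷_; concatMap)
open import Data.Bool.ListAction using (any)
open import Data.Product using (Σ; _×_; ∃; _,_)
open import Relation.Binary.PropositionalEquality using (_≡_)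
open import Relation.Nullary using (¬_)

-- At step m the target position is
--   m + ⌊m/2⌋  if m is odd or (m - ⌊m/2⌋) was assigned at an earlier step,
--   m - ⌊m/2⌋  otherwise.
-- (Step 1 falls under the general rule: 1 is odd, target 1 + 0 = 1.)

isOdd : ℕ → Bool
isOdd m = (m % 2) ≡ᵇ 1

assignedIn : ℕ → List ℕ → Bool
assignedIn x l = any (λ y → y ≡ᵇ x) l

stepTarget : ℕ → List ℕ → ℕ
stepTarget m prev =
  if isOdd m ∨ assignedIn (m ∸ m / 2) prev then m + m / 2 else m ∸ m / 2

hist : ℕ → List ℕ
hist zero = []
hist (suc m) = stepTarget (suc m) (hist m) ∷ hist m

-- target m = the position n at which step m sets Π_odd(n) = m  (m ≥ 1)
target : ℕ → ℕ
target zero = zero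
target (suc m) = stepTarget (suc m) (hist m)

-- Π_odd(n) = v : step v sets position n to v and no later step overwrites it.
PiOdd : ℕ → ℕ → Set
PiOdd n v = (1 ≤ v) × (target v ≡ n) × (∀ m → v < m → ¬ (target m ≡ n))

IsRecordPos : ℕ → Set
IsRecordPos n =
  (1 ≤ n) × Σ ℕ (λ v → PiOdd n v ×
    (∀ m w → 1 ≤ m → m < n → PiOdd m w → w < v))

τ₁ : ℕ → List ℕ
τ₁ 1 = 1 ∷ 2 ∷ []
τ₁ 2 = 3 ∷ 1 ∷ 2 ∷ []
τ₁ 3 = 3 ∷ 3 ∷ 1 ∷ 2 ∷ []
τ₁ _ = []

τ : List ℕ → List ℕ
τ = concatMap τ₁

τ^ : ℕ → List ℕ → List ℕ
τ^ zero w = w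
τ^ (suc k) w = τ (τ^ k w)

-- 1-indexed lookup with default 0
nth : List ℕ → ℕ → ℕ
nth [] _ = 0
nth (x ∷ xs) 1 = x
nth (x ∷ xs) (suc (suc k)) = nth xs (suc k)
nth (x ∷ xs) zero = 0

-- t(n) = n-th letter of τ^n(1); τ^n(1) is a prefix of the fixed point of
-- length ≥ n+1, so this is the n-th letter of the fixed point t.
t : ℕ → ℕ
t n = nth (τ^ n (1 ∷ [])) n

IsRecordEnum : (ℕ → ℕ) → Set
IsRecordEnum R =
  (∀ k → 1 ≤ k → R k < R (suc k)) ×
  (∀ n → (IsRecordPos n → Σ ℕ (λ k → (1 ≤ k) × (R k ≡ n))) ×
         (Σ ℕ (λ k → (1 ≤ k) × (R k ≡ n)) → IsRecordPos n))

module Submission where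

-- Write 2K and 2K+1 for the even and odd steps, and let χ be the
-- 0/1-sequence with χ 0 = 1, χ(3q) = χ q, χ(3q+1) = 0, χ(3q+2) = 1 (the fixed
-- point of the morphism σ : b ↦ b 0 1).
--   (1) Odd step 2k+1 always sends its value to position 3k+1; even step 2K
--       (K ≥ 1) sends it to K when χ K = 1 and to 3K otherwise.  This is proved
--       by strong induction on K: K is occupied before step 2K exactly when
--       χ K = 0.
--   (2) Hence the step ↦ position map is injective, every position n with
--       χ n = 1 has value Π_odd(n) = 2n, and every step w ≤ 2·(its position).
--       The record positions are therefore 1 together with the n ≥ 1 with χ n = 1.
--   (3) The fixed point t of τ is the image of χ under the coding
--       1 ↦ 12, 0 ↦ 3, because τ ∘ code = code ∘ σ.
--   (4) Define R(1) = 1, R(2) = 2, R(k+1) = R(k) + t(k+1).  Reading t block by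
--       block shows that R enumerates exactly the positions n ≥ 1 with χ n = 1
--       together with 1, which gives both identities of the theorem.

open import Defs
open import Data.Nat using (ℕ; zero; suc; pred; _+_; _*_; _∸_; _/_; _%_; _≡ᵇ_; _≤_; _<_; z≤n; s≤s; _≟_; _<?_)
open import Data.Nat.Properties
open import Data.Nat.DivMod using (m/n≡1+[m∸n]/n)
open import Data.Nat.Induction using (<-rec)
open import Data.Bool using (Bool; true; false; not; if_then_else_)
open import Data.Bool.Properties using (T-≡; ¬-not)
open import Data.List using (List; []; _∷_; _++_; length; concat; map)
open import Data.List.Properties using (length-++; map-++; concat-++; ++-identityʳ)
open import Data.Product using (Σ; _×_; ∃; _,_; proj₁; proj₂)
open import Data.Sum using (_⊎_; inj₁; inj₂)
open import Data.Empty using (⊥-elim)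
open import Function using (_∘_)
open import Function.Bundles using (Equivalence)
open import Relation.Nullary using (¬_; yes; no)
open import Relation.Binary.PropositionalEquality

-- Doubling and tripling by structural recursion, so that the parity and
-- ternary views below hold definitionally.
double : ℕ → ℕ
double zero = zero
double (suc k) = suc (suc (double k))

triple : ℕ → ℕ
triple zero = zero
triple (suc q) = suc (suc (suc (triple q)))

double≡+ : ∀ k → double k ≡ k + k
double≡+ zero = refl
double≡+ (suc k) = cong suc (trans (cong suc (double≡+ k)) (sym (+-suc k k)))

triple≡ : ∀ q → triple q ≡ double q + q
triple≡ zero = refl
triple≡ (suc q) = cong (suc ∘ suc) (trans (cong suc (triple≡ q)) (sym (+-suc (double q) q)))

double-+ : ∀ a b → double (a + b) ≡ double a + 2 * b
double-+ zero b = trans (double≡+ b) (cong (b +_) (sym (+-identityʳ b)))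
double-+ (suc a) b = cong (suc ∘ suc) (double-+ a b)

double-mono : ∀ {a b} → a ≤ b → double a ≤ double b
double-mono z≤n = z≤n
double-mono (s≤s a≤b) = s≤s (s≤s (double-mono a≤b))

double-mono-< : ∀ {a b} → a < b → double a < double b
double-mono-< (s≤s a≤b) = s≤s (≤-trans (double-mono a≤b) (n≤1+n _))

double-cancel-< : ∀ {a b} → double a < double b → a < b
double-cancel-< {zero} {suc b} _ = s≤s z≤n
double-cancel-< {suc a} {suc b} (s≤s (s≤s lt)) = s≤s (double-cancel-< lt)

≤pred-double⇒< : ∀ K {i} → 1 ≤ i → i ≤ pred (double K) → i < double K
≤pred-double⇒< zero (s≤s z≤n) ()
≤pred-double⇒< (suc K) _ i≤ = s≤s i≤

≤-triple : ∀ q → q ≤ triple q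
≤-triple zero = z≤n
≤-triple (suc q) = s≤s (≤-trans (≤-triple q) (≤-trans (n≤1+n _) (n≤1+n _)))

<-triple : ∀ q → 1 ≤ q → q < triple q
<-triple (suc q) _ = s≤s (s≤s (≤-trans (≤-triple q) (n≤1+n _)))

data Parity : ℕ → Set where
  even : ∀ k → Parity (double k)
  odd  : ∀ k → Parity (suc (double k))

parity : ∀ n → Parity n
parity zero = even 0
parity (suc zero) = odd 0
parity (suc (suc n)) with parity n
... | even k = even (suc k)
... | odd k = odd (suc k)

data Mod3 : ℕ → Set where
  rem0 : ∀ q → Mod3 (triple q)
  rem1 : ∀ q → Mod3 (suc (triple q))
  rem2 : ∀ q → Mod3 (suc (suc (triple q)))

mod3 : ∀ n → Mod3 n
mod3 zero = rem0 0
mod3 (suc zero) = rem1 0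
mod3 (suc (suc zero)) = rem2 0
mod3 (suc (suc (suc n))) with mod3 n
... | rem0 q = rem0 (suc q)
... | rem1 q = rem1 (suc q)
... | rem2 q = rem2 (suc q)

data Residue : Set where
  r0 r1 r2 : Residue

divMod3 : ℕ → ℕ × Residue
divMod3 zero = 0 , r0
divMod3 (suc zero) = 0 , r1
divMod3 (suc (suc zero)) = 0 , r2
divMod3 (suc (suc (suc n))) = suc (proj₁ (divMod3 n)) , proj₂ (divMod3 n)

divMod3-rem0 : ∀ q → divMod3 (triple q) ≡ (q , r0)
divMod3-rem0 zero = refl
divMod3-rem0 (suc q) rewrite divMod3-rem0 q = refl

divMod3-rem1 : ∀ q → divMod3 (suc (triple q)) ≡ (q , r1)
divMod3-rem1 zero = refl
divMod3-rem1 (suc q) rewrite divMod3-rem1 q = refl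

divMod3-rem2 : ∀ q → divMod3 (suc (suc (triple q))) ≡ (q , r2)
divMod3-rem2 zero = refl
divMod3-rem2 (suc q) rewrite divMod3-rem2 q = refl

triple-injective : ∀ {a b} → triple a ≡ triple b → a ≡ b
triple-injective {a} {b} eq =
  cong proj₁ (trans (sym (divMod3-rem0 a)) (trans (cong divMod3 eq) (divMod3-rem0 b)))

triple+1≢triple : ∀ {a b} → suc (triple a) ≢ triple b
triple+1≢triple {a} {b} eq
  with trans (sym (divMod3-rem1 a)) (trans (cong divMod3 eq) (divMod3-rem0 b))
... | ()

-- χ n = true iff the last nonzero ternary digit of n is 2 (and χ 0 = true).
-- It is computed with fuel; fuel n suffices for argument n.
χ-fuel : ℕ → ℕ → Bool
χ-fuel zero n = true
χ-fuel (suc f) n with divMod3 n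
... | q , r0 = χ-fuel f q
... | q , r1 = false
... | q , r2 = true

χ : ℕ → Bool
χ n = χ-fuel (suc n) n

χ-fuel-zero : ∀ f → χ-fuel f 0 ≡ true
χ-fuel-zero zero = refl
χ-fuel-zero (suc f) = χ-fuel-zero f

χ-fuel-stable : ∀ f g n → n ≤ f → n ≤ g → χ-fuel (suc f) n ≡ χ-fuel (suc g) n
χ-fuel-stable f g n n≤f n≤g with mod3 n
χ-fuel-stable f g .(triple q) n≤f n≤g | rem0 q rewrite divMod3-rem0 q with q
... | zero = trans (χ-fuel-zero f) (sym (χ-fuel-zero g))
... | suc q' with f | g | n≤f | n≤g
...   | suc f' | suc g' | s≤s n≤f' | s≤s n≤g' =
  χ-fuel-stable f' g' (suc q')
    (≤-trans (s≤s (≤-triple q')) (≤-trans (n≤1+n _) n≤f'))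
    (≤-trans (s≤s (≤-triple q')) (≤-trans (n≤1+n _) n≤g'))
χ-fuel-stable f g .(suc (triple q)) _ _ | rem1 q rewrite divMod3-rem1 q = refl
χ-fuel-stable f g .(suc (suc (triple q))) _ _ | rem2 q rewrite divMod3-rem2 q = refl

χ-rem0 : ∀ q → χ (triple q) ≡ χ q
χ-rem0 zero = refl
χ-rem0 (suc q) rewrite divMod3-rem0 (suc q) =
  χ-fuel-stable (suc (suc (triple q))) (suc q) (suc q)
    (s≤s (≤-trans (≤-triple q) (n≤1+n _))) ≤-refl

χ-rem1 : ∀ q → χ (suc (triple q)) ≡ false
χ-rem1 q rewrite divMod3-rem1 q = refl

χ-rem2 : ∀ q → χ (suc (suc (triple q))) ≡ true
χ-rem2 q rewrite divMod3-rem2 q = refl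

true≢false : true ≢ false
true≢false ()

mod2-odd : ∀ k → suc (double k) % 2 ≡ 1
mod2-odd zero = refl
mod2-odd (suc k) = mod2-odd k

mod2-even : ∀ k → double k % 2 ≡ 0
mod2-even zero = refl
mod2-even (suc k) = mod2-even k

half-even : ∀ k → double k / 2 ≡ k
half-even zero = refl
half-even (suc k) =
  trans (m/n≡1+[m∸n]/n {suc (suc (double k))} {2} (s≤s (s≤s z≤n))) (cong suc (half-even k))

half-odd : ∀ k → suc (double k) / 2 ≡ k
half-odd zero = refl
half-odd (suc k) =
  trans (m/n≡1+[m∸n]/n {suc (suc (suc (double k)))} {2} (s≤s (s≤s z≤n))) (cong suc (half-odd k))

double∸ : ∀ k → double k ∸ k ≡ k
double∸ k rewrite double≡+ k = m+n∸n≡m k k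

target-odd : ∀ k → target (suc (double k)) ≡ suc (triple k)
target-odd k rewrite mod2-odd k | half-odd k | triple≡ k = refl

target-even : ∀ k → target (double (suc k)) ≡
  (if assignedIn (suc k) (hist (suc (double k))) then triple (suc k) else suc k)
target-even k rewrite mod2-even (suc k) | half-even (suc k) | double∸ (suc k) | sym (triple≡ (suc k)) = refl

≡ᵇ-true : ∀ {x y} → x ≡ y → (x ≡ᵇ y) ≡ true
≡ᵇ-true {x} refl = Equivalence.to T-≡ (≡⇒≡ᵇ x x refl)

≡ᵇ-false : ∀ {x y} → x ≢ y → (x ≡ᵇ y) ≡ false
≡ᵇ-false {x} {y} x≢y = ¬-not (λ eq → x≢y (≡ᵇ⇒≡ x y (Equivalence.from T-≡ eq)))

assigned : ∀ {x} m i → 1 ≤ i → i ≤ m → target i ≡ x → assignedIn x (hist m) ≡ true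
assigned zero i (s≤s _) () _
assigned {x} (suc m) i 1≤i i≤m eq with i ≟ suc m
... | yes refl rewrite eq | ≡ᵇ-true {x} refl = refl
... | no i≢m with target (suc m) ≡ᵇ x
...   | true = refl
...   | false = assigned m i 1≤i (≤-pred (≤∧≢⇒< i≤m i≢m)) eq

unassigned : ∀ x m → (∀ i → 1 ≤ i → i ≤ m → target i ≢ x) → assignedIn x (hist m) ≡ false
unassigned x zero _ = refl
unassigned x (suc m) miss rewrite ≡ᵇ-false (miss (suc m) (s≤s z≤n) ≤-refl) =
  unassigned x m (λ i 1≤i i≤m → miss i 1≤i (m≤n⇒m≤1+n i≤m))

evenTarget : ℕ → ℕ
evenTarget K = if χ K then K else triple K

evenTarget-cases : ∀ a →
  (χ a ≡ true × evenTarget a ≡ a) ⊎ (χ a ≡ false × evenTarget a ≡ triple a)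
evenTarget-cases a with χ a
... | true = inj₁ (refl , refl)
... | false = inj₂ (refl , refl)

evenTarget-unmarked : ∀ a → χ a ≡ false → evenTarget a ≡ triple a
evenTarget-unmarked a c rewrite c = refl

-- Multiplying by 3 does not change χ, so evenTarget preserves χ.
χ-evenTarget : ∀ a → χ (evenTarget a) ≡ χ a
χ-evenTarget a with evenTarget-cases a
... | inj₁ (_ , ea) = cong χ ea
... | inj₂ (_ , ea) = trans (cong χ ea) (χ-rem0 a)

evenTarget-marked : ∀ a → χ (evenTarget a) ≡ true → evenTarget a ≡ a
evenTarget-marked a c with evenTarget-cases a
... | inj₁ (_ , ea) = ea
... | inj₂ (ca , _) = ⊥-elim (true≢false (trans (sym c) (trans (χ-evenTarget a) ca)))

EvenStepsBelow : ℕ → Set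
EvenStepsBelow K = ∀ a → 1 ≤ a → a < K → target (double a) ≡ evenTarget a

earlier-target : ∀ K → EvenStepsBelow K → ∀ i → 1 ≤ i → i ≤ pred (double K) →
  (∃ λ a → target i ≡ suc (triple a)) ⊎ (∃ λ a → a < K × target i ≡ evenTarget a)
earlier-target K below i 1≤i i≤ with parity i
... | odd a = inj₁ (a , target-odd a)
... | even zero with 1≤i
...   | ()
earlier-target K below i 1≤i i≤ | even (suc a) =
  inj₂ (suc a , a<K , below (suc a) (s≤s z≤n) a<K)
  where
    a<K : suc a < K
    a<K = double-cancel-< (≤pred-double⇒< K 1≤i i≤)

marked-free : ∀ K → EvenStepsBelow K → χ K ≡ true → assignedIn K (hist (pred (double K))) ≡ false
marked-free K below c = unassigned K _ miss
  where
    miss : ∀ i → 1 ≤ i → i ≤ pred (double K) → target i ≢ K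
    miss i 1≤i i≤ hit with earlier-target K below i 1≤i i≤
    ... | inj₁ (a , e) = true≢false (trans (sym c) (trans (cong χ (trans (sym hit) e)) (χ-rem1 a)))
    ... | inj₂ (a , a<K , e) = <-irrefl (trans (sym back) K≡) a<K
      where
        K≡ : evenTarget a ≡ K
        K≡ = trans (sym e) hit
        back : evenTarget a ≡ a
        back = evenTarget-marked a (trans (cong χ K≡) c)

-- An unmarked position K ≥ 1 is already occupied when step 2K is performed:
-- by step 2q+1 if K = 3q+1, and by step 2(q+1) if K = 3(q+1) with q+1 unmarked.
unmarked-occupied : ∀ K → 1 ≤ K → EvenStepsBelow K → χ K ≡ false →
  assignedIn K (hist (pred (double K))) ≡ true
unmarked-occupied K 1≤K below c with mod3 K
... | rem1 q = assigned _ (suc (double q)) (s≤s z≤n) (s≤s (double-mono (≤-triple q))) (target-odd q)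
... | rem2 q = ⊥-elim (true≢false (trans (sym (χ-rem2 q)) c))
... | rem0 zero with 1≤K
...   | ()
unmarked-occupied K 1≤K below c | rem0 (suc q) =
  assigned _ (double (suc q)) (s≤s z≤n) (≤-pred (double-mono-< q+1<K))
    (trans (below (suc q) (s≤s z≤n) q+1<K) (evenTarget-unmarked (suc q) (trans (sym (χ-rem0 (suc q))) c)))
  where
    q+1<K : suc q < triple (suc q)
    q+1<K = <-triple (suc q) (s≤s z≤n)

if-not : ∀ {A : Set} c (x y : A) → (if not c then y else x) ≡ (if c then x else y)
if-not true x y = refl
if-not false x y = refl

target-even-step : ∀ K → 1 ≤ K → target (double K) ≡ evenTarget K
target-even-step = <-rec _ step
  where
    step : ∀ K → (∀ {a} → a < K → 1 ≤ a → target (double a) ≡ evenTarget a) →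
           1 ≤ K → target (double K) ≡ evenTarget K
    step zero _ ()
    step (suc k) ih 1≤K = begin
      target (double (suc k))
        ≡⟨ target-even k ⟩
      (if assignedIn (suc k) (hist (suc (double k))) then triple (suc k) else suc k)
        ≡⟨ cong (λ b → if b then triple (suc k) else suc k) occupied ⟩
      (if not (χ (suc k)) then triple (suc k) else suc k)
        ≡⟨ if-not (χ (suc k)) (suc k) (triple (suc k)) ⟩
      evenTarget (suc k) ∎
      where
        open ≡-Reasoning
        below : EvenStepsBelow (suc k)
        below a 1≤a a<K = ih a<K 1≤a
        occupied : assignedIn (suc k) (hist (suc (double k))) ≡ not (χ (suc k))
        occupied with χ (suc k) in c
        ... | true = marked-free (suc k) below c
        ... | false = unmarked-occupied (suc k) 1≤K below c

triple+1≢evenTarget : ∀ a b → suc (triple a) ≢ evenTarget b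
triple+1≢evenTarget a b eq with evenTarget-cases b
... | inj₁ (cb , eb) = true≢false (trans (sym cb) (trans (cong χ (trans (sym eb) (sym eq))) (χ-rem1 a)))
... | inj₂ (_ , eb) = triple+1≢triple (trans eq eb)

same-mark : ∀ {a b} → evenTarget a ≡ evenTarget b → χ a ≡ χ b
same-mark {a} {b} eq = trans (sym (χ-evenTarget a)) (trans (cong χ eq) (χ-evenTarget b))

-- Distinct even steps land on distinct positions: by same-mark both lie in
-- the same case of evenTarget.
evenTarget-injective : ∀ {a b} → evenTarget a ≡ evenTarget b → a ≡ b
evenTarget-injective {a} {b} eq with evenTarget-cases a | evenTarget-cases b
... | inj₁ (_ , ea) | inj₁ (_ , eb) = trans (sym ea) (trans eq eb)
... | inj₂ (_ , ea) | inj₂ (_ , eb) = triple-injective (trans (sym ea) (trans eq eb))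
... | inj₁ (ca , _) | inj₂ (cb , _) = ⊥-elim (true≢false (trans (sym ca) (trans (same-mark {a} {b} eq) cb)))
... | inj₂ (ca , _) | inj₁ (cb , _) = ⊥-elim (true≢false (trans (sym cb) (trans (sym (same-mark {a} {b} eq)) ca)))

≤-evenTarget : ∀ a → a ≤ evenTarget a
≤-evenTarget a with evenTarget-cases a
... | inj₁ (_ , ea) = ≤-reflexive (sym ea)
... | inj₂ (_ , ea) = ≤-trans (≤-triple a) (≤-reflexive (sym ea))

1≤half : ∀ a → 1 ≤ double a → 1 ≤ a
1≤half (suc a) _ = s≤s z≤n

target-injective : ∀ {v w} → 1 ≤ v → 1 ≤ w → target v ≡ target w → v ≡ w
target-injective {v} {w} 1≤v 1≤w eq with parity v | parity w
... | odd a | odd b =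
  cong (suc ∘ double) (triple-injective (suc-injective (trans (sym (target-odd a)) (trans eq (target-odd b)))))
... | odd a | even b =
  ⊥-elim (triple+1≢evenTarget a b
    (trans (sym (target-odd a)) (trans eq (target-even-step b (1≤half b 1≤w)))))
... | even a | odd b =
  ⊥-elim (triple+1≢evenTarget b a
    (trans (sym (target-odd b)) (trans (sym eq) (target-even-step a (1≤half a 1≤v)))))
... | even a | even b =
  cong double (evenTarget-injective
    (trans (sym (target-even-step a (1≤half a 1≤v))) (trans eq (target-even-step b (1≤half b 1≤w)))))

step≤double-target : ∀ w → 1 ≤ w → w ≤ double (target w)
step≤double-target w 1≤w with parity w
... | odd a rewrite target-odd a = s≤s (m≤n⇒m≤1+n (double-mono (≤-triple a)))
... | even a rewrite target-even-step a (1≤half a 1≤w) = double-mono (≤-evenTarget a)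

-- By injectivity, the step writing to n is its final value.
PiOdd-intro : ∀ {n v} → 1 ≤ v → target v ≡ n → PiOdd n v
PiOdd-intro {v = v} 1≤v eq = 1≤v , eq , λ m v<m eq′ →
  <-irrefl (target-injective 1≤v (≤-trans 1≤v (<⇒≤ v<m)) (trans eq (sym eq′))) v<m

PiOdd-unique : ∀ {n v w} → PiOdd n v → PiOdd n w → v ≡ w
PiOdd-unique (1≤v , ev , _) (1≤w , ew , _) = target-injective 1≤v 1≤w (trans ev (sym ew))

PiOdd-marked : ∀ {n} → 1 ≤ n → χ n ≡ true → PiOdd n (double n)
PiOdd-marked {suc n} _ c =
  PiOdd-intro (s≤s z≤n) (trans (target-even-step (suc n) (s≤s z≤n))
    (evenTarget-marked (suc n) (trans (χ-evenTarget (suc n)) c)))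

PiOdd-marked-value : ∀ {n v} → 1 ≤ n → χ n ≡ true → PiOdd n v → v ≡ double n
PiOdd-marked-value 1≤n c p = PiOdd-unique p (PiOdd-marked 1≤n c)

record-1 : IsRecordPos 1
record-1 = s≤s z≤n , 1 , PiOdd-intro (s≤s z≤n) refl , λ { m w (s≤s z≤n) (s≤s ()) _ }

-- A marked position is a record: every earlier position m holds a value w ≤ 2m < 2n.
record-marked : ∀ {n} → 1 ≤ n → χ n ≡ true → IsRecordPos n
record-marked {n} 1≤n c = 1≤n , double n , PiOdd-marked 1≤n c , earlier-smaller
  where
    earlier-smaller : ∀ m w → 1 ≤ m → m < n → PiOdd m w → w < double n
    earlier-smaller m w _ m<n (1≤w , tw , _) = begin-strict
      w                    ≤⟨ step≤double-target w 1≤w ⟩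
      double (target w)    ≡⟨ cong double tw ⟩
      double m             <⟨ double-mono-< m<n ⟩
      double n             ∎
      where open ≤-Reasoning

-- A position beyond 3q+2 holding a value at most 2q+3 is not a record,
-- since position 3q+2 holds the larger value 2(3q+2).
outdone : ∀ q {n v} → suc (suc (triple q)) < n → v ≤ suc (double (suc q)) →
  ¬ (∀ m w → 1 ≤ m → m < n → PiOdd m w → w < v)
outdone q m<n v≤ beats =
  <⇒≱ (double-mono-< (s≤s (s≤s (≤-triple q))))
    (≤-pred (≤-trans (beats _ _ (s≤s z≤n) m<n (PiOdd-marked (s≤s z≤n) (χ-rem2 q))) v≤))

record-marked-only : ∀ {n} → IsRecordPos n → n ≡ 1 ⊎ χ n ≡ true
record-marked-only {n} (1≤n , v , pv , beats) with mod3 n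
... | rem2 q = inj₂ (χ-rem2 q)
... | rem1 zero = inj₁ refl
... | rem1 (suc q) = ⊥-elim (outdone q (n≤1+n _) (≤-reflexive v≡) beats)
  where
    v≡ : v ≡ suc (double (suc q))
    v≡ = PiOdd-unique pv (PiOdd-intro (s≤s z≤n) (target-odd (suc q)))
... | rem0 zero with 1≤n
...   | ()
record-marked-only {n} (1≤n , v , pv , beats) | rem0 (suc q) with χ (suc q) in c
... | true = inj₂ (trans (χ-rem0 (suc q)) c)
... | false = ⊥-elim (outdone q ≤-refl (≤-trans (≤-reflexive v≡) (n≤1+n _)) beats)
  where
    v≡ : v ≡ double (suc q)
    v≡ = PiOdd-unique pv (PiOdd-intro (s≤s z≤n)
      (trans (target-even-step (suc q) (s≤s z≤n)) (evenTarget-unmarked (suc q) c)))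

code : Bool → List ℕ
code true = 1 ∷ 2 ∷ []
code false = 3 ∷ []

codeWord : List Bool → List ℕ
codeWord w = concat (map code w)

σ : List Bool → List Bool
σ w = concat (map (λ b → b ∷ false ∷ true ∷ []) w)

concatMap-++ : ∀ {A B : Set} (f : A → List B) xs ys →
  concat (map f (xs ++ ys)) ≡ concat (map f xs) ++ concat (map f ys)
concatMap-++ f xs ys = trans (cong concat (map-++ f xs ys)) (sym (concat-++ (map f xs) (map f ys)))

τ-codeWord : ∀ w → τ (codeWord w) ≡ codeWord (σ w)
τ-codeWord [] = refl
τ-codeWord (b ∷ w) = begin
  τ (code b ++ codeWord w)                 ≡⟨ concatMap-++ τ₁ (code b) (codeWord w) ⟩
  τ (code b) ++ τ (codeWord w)             ≡⟨ cong₂ _++_ (τ-code b) (τ-codeWord w) ⟩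
  codeWord (b ∷ false ∷ true ∷ []) ++ codeWord (σ w)
    ≡⟨ sym (concatMap-++ code (b ∷ false ∷ true ∷ []) (σ w)) ⟩
  codeWord (σ (b ∷ w))                     ∎
  where
    open ≡-Reasoning
    τ-code : ∀ b → τ (code b) ≡ codeWord (b ∷ false ∷ true ∷ [])
    τ-code true = refl
    τ-code false = refl

segment : ℕ → ℕ → List Bool
segment j zero = []
segment j (suc N) = χ j ∷ segment (suc j) N

segment-++ : ∀ i M j → segment j (i + M) ≡ segment j i ++ segment (j + i) M
segment-++ zero M j rewrite +-identityʳ j = refl
segment-++ (suc i) M j rewrite segment-++ i M (suc j) | +-suc j i = refl

-- χ is a fixed point of σ: σ maps the segment at j of length N to the one at 3j of length 3N.
σ-segment : ∀ N j → σ (segment j N) ≡ segment (triple j) (triple N)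
σ-segment zero j = refl
σ-segment (suc N) j rewrite σ-segment N (suc j) | χ-rem0 j | χ-rem1 j | χ-rem2 j = refl

-- pow3 k = 3^k, the length of σ^k(1); n < 3^n makes τ^n(1) long enough to contain position n.
pow3 : ℕ → ℕ
pow3 zero = 1
pow3 (suc k) = triple (pow3 k)

n<pow3 : ∀ n → n < pow3 n
n<pow3 zero = s≤s z≤n
n<pow3 (suc n) = ≤-trans (s≤s (n<pow3 n)) (<-triple (pow3 n) (≤-trans (s≤s z≤n) (n<pow3 n)))

τ^-prefix : ∀ k → τ^ (suc k) (1 ∷ []) ≡ codeWord (segment 0 (pow3 k))
τ^-prefix zero = refl
τ^-prefix (suc k) = begin
  τ (τ^ (suc k) (1 ∷ []))               ≡⟨ cong τ (τ^-prefix k) ⟩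
  τ (codeWord (segment 0 (pow3 k)))     ≡⟨ τ-codeWord (segment 0 (pow3 k)) ⟩
  codeWord (σ (segment 0 (pow3 k)))     ≡⟨ cong codeWord (σ-segment (pow3 k) 0) ⟩
  codeWord (segment 0 (pow3 (suc k)))   ∎
  where open ≡-Reasoning

-- Position where the code of χ i starts inside t (0-based).
blockStart : ℕ → ℕ
blockStart zero = 0
blockStart (suc j) = blockStart j + length (code (χ j))

length-codeWord : ∀ i → length (codeWord (segment 0 i)) ≡ blockStart i
length-codeWord zero = refl
length-codeWord (suc i) = begin
  length (codeWord (segment 0 (suc i)))              ≡⟨ cong (length ∘ codeWord ∘ segment 0) (+-comm 1 i) ⟩
  length (codeWord (segment 0 (i + 1)))              ≡⟨ cong (length ∘ codeWord) (segment-++ i 1 0) ⟩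
  length (codeWord (segment 0 i ++ χ i ∷ []))        ≡⟨ cong length (concatMap-++ code (segment 0 i) (χ i ∷ [])) ⟩
  length (codeWord (segment 0 i) ++ code (χ i) ++ [])  ≡⟨ length-++ (codeWord (segment 0 i)) ⟩
  length (codeWord (segment 0 i)) + length (code (χ i) ++ [])
    ≡⟨ cong₂ _+_ (length-codeWord i) (cong length (++-identityʳ (code (χ i)))) ⟩
  blockStart (suc i)                                 ∎
  where open ≡-Reasoning

block-decomposition : ∀ i N → i < N → ∃ λ rest →
  codeWord (segment 0 N) ≡ codeWord (segment 0 i) ++ code (χ i) ++ rest
block-decomposition i N i<N = codeWord (segment (suc i) M) , (begin
  codeWord (segment 0 N)                ≡⟨ cong (codeWord ∘ segment 0) (sym N≡) ⟩
  codeWord (segment 0 (i + suc M))      ≡⟨ cong codeWord (segment-++ i (suc M) 0) ⟩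
  codeWord (segment 0 i ++ segment i (suc M))
    ≡⟨ concatMap-++ code (segment 0 i) (segment i (suc M)) ⟩
  codeWord (segment 0 i) ++ code (χ i) ++ codeWord (segment (suc i) M)  ∎)
  where
    open ≡-Reasoning
    M = N ∸ suc i
    N≡ : i + suc M ≡ N
    N≡ = trans (+-suc i M) (m+[n∸m]≡n i<N)

lead : Bool → ℕ
lead true = 1
lead false = 3

nth-after : ∀ xs b ys → nth (xs ++ code b ++ ys) (suc (length xs)) ≡ lead b
nth-after [] true ys = refl
nth-after [] false ys = refl
nth-after (x ∷ xs) b ys = nth-after xs b ys

nth-after₂ : ∀ xs ys → nth (xs ++ code true ++ ys) (suc (suc (length xs))) ≡ 2
nth-after₂ [] ys = refl
nth-after₂ (x ∷ xs) ys = nth-after₂ xs ys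

-- Blocks are nonempty, so blockStart is strictly increasing and blockStart i ≥ i.
1≤length-code : ∀ b → 1 ≤ length (code b)
1≤length-code true = s≤s z≤n
1≤length-code false = s≤s z≤n

blockStart-< : ∀ j → blockStart j < blockStart (suc j)
blockStart-< j = subst (_≤ blockStart (suc j)) (+-comm (blockStart j) 1)
  (+-monoʳ-≤ (blockStart j) (1≤length-code (χ j)))

i≤blockStart : ∀ i → i ≤ blockStart i
i≤blockStart zero = z≤n
i≤blockStart (suc i) = ≤-trans (s≤s (i≤blockStart i)) (blockStart-< i)

t-block-lead : ∀ i → t (suc (blockStart i)) ≡ lead (χ i)
t-block-lead i with block-decomposition i (pow3 (blockStart i)) (≤-<-trans (i≤blockStart i) (n<pow3 _))
... | rest , split
  rewrite τ^-prefix (blockStart i) | split | sym (length-codeWord i) =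
    nth-after (codeWord (segment 0 i)) (χ i) rest

t-block-second : ∀ i → χ i ≡ true → t (suc (suc (blockStart i))) ≡ 2
t-block-second i c with block-decomposition i (pow3 (suc (blockStart i)))
  (≤-<-trans (i≤blockStart i) (<-trans (n<1+n _) (n<pow3 _)))
... | rest , split
  rewrite τ^-prefix (suc (blockStart i)) | split | c | sym (length-codeWord i) =
    nth-after₂ (codeWord (segment 0 i)) rest

block-of : ∀ p → ∃ λ j → blockStart j ≤ p × p < blockStart (suc j)
block-of zero = 0 , z≤n , s≤s z≤n
block-of (suc p) with block-of p
... | j , start≤p , p<end with suc p <? blockStart (suc j)
...   | yes p+1<end = j , ≤-trans start≤p (n≤1+n p) , p+1<end
...   | no p+1≮end = suc j , ≮⇒≥ p+1≮end , ≤-<-trans p<end (blockStart-< (suc j))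

position-in-block : ∀ j p → blockStart j ≤ p → p < blockStart (suc j) →
  p ≡ blockStart j ⊎ (p ≡ suc (blockStart j) × χ j ≡ true)
position-in-block j p start≤p p<end with p ≟ blockStart j
... | yes p≡ = inj₁ p≡
... | no p≢ with χ j
...   | true = inj₂ (≤-antisym (≤-pred (subst (p <_) (+-comm (blockStart j) 2) p<end))
                               (≤∧≢⇒< start≤p (p≢ ∘ sym)) , refl)
...   | false = ⊥-elim (p≢ (≤-antisym (≤-pred (subst (p <_) (+-comm (blockStart j) 1) p<end)) start≤p))

t-positive : ∀ p → 1 ≤ t (suc p)
t-positive p with block-of p
... | j , start≤p , p<end with position-in-block j p start≤p p<end
...   | inj₁ refl rewrite t-block-lead j = 1≤lead (χ j)
  where
    1≤lead : ∀ b → 1 ≤ lead b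
    1≤lead true = s≤s z≤n
    1≤lead false = s≤s z≤n
...   | inj₂ (refl , c) rewrite t-block-second j c = s≤s z≤n

R : ℕ → ℕ
R zero = 0
R (suc zero) = 1
R (suc (suc zero)) = 2
R (suc (suc (suc k))) = R (suc (suc k)) + t (suc (suc (suc k)))

R-step : ∀ k → 2 ≤ k → R (suc k) ≡ R k + t (suc k)
R-step (suc (suc k)) _ = refl
R-step (suc zero) (s≤s ())

R-increasing : ∀ k → 1 ≤ k → R k < R (suc k)
R-increasing (suc zero) _ = s≤s (s≤s z≤n)
R-increasing (suc (suc k)) _ = m<m+n (R (suc (suc k))) (t-positive (suc (suc k)))

-- Block 0 has length 2, so every later block starts at position ≥ 2.
2≤blockStart : ∀ j → 2 ≤ blockStart (suc j)
2≤blockStart zero = ≤-refl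
2≤blockStart (suc j) = ≤-trans (2≤blockStart j) (<⇒≤ (blockStart-< (suc j)))

-- Block by block, R visits the marked positions: the end of block j+1 is
-- position 3j+2, and the extra letter of a long block j+1 is position 3(j+1).
R-block-end : ∀ j → R (blockStart (suc j)) ≡ suc (suc (triple j))
R-block-second : ∀ j → χ (suc j) ≡ true → R (suc (blockStart (suc j))) ≡ triple (suc j)

R-block-second j c = begin
  R (suc (blockStart (suc j)))                         ≡⟨ R-step _ (2≤blockStart j) ⟩
  R (blockStart (suc j)) + t (suc (blockStart (suc j)))
    ≡⟨ cong₂ _+_ (R-block-end j) (trans (t-block-lead (suc j)) (cong lead c)) ⟩
  suc (suc (triple j)) + 1                             ≡⟨ +-comm _ 1 ⟩
  triple (suc j)                                       ∎
  where open ≡-Reasoning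

R-block-end zero = refl
R-block-end (suc j) with χ (suc j) in c
... | true = begin
  R (blockStart (suc j) + 2)                            ≡⟨ cong R (+-comm (blockStart (suc j)) 2) ⟩
  R (suc (suc (blockStart (suc j))))
    ≡⟨ R-step _ (≤-trans (2≤blockStart j) (n≤1+n _)) ⟩
  R (suc (blockStart (suc j))) + t (suc (suc (blockStart (suc j))))
    ≡⟨ cong₂ _+_ (R-block-second j c) (t-block-second (suc j) c) ⟩
  triple (suc j) + 2                                    ≡⟨ +-comm (triple (suc j)) 2 ⟩
  suc (suc (triple (suc j)))                            ∎
  where open ≡-Reasoning
... | false = begin
  R (blockStart (suc j) + 1)                            ≡⟨ cong R (+-comm (blockStart (suc j)) 1) ⟩
  R (suc (blockStart (suc j)))                          ≡⟨ R-step _ (2≤blockStart j) ⟩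
  R (blockStart (suc j)) + t (suc (blockStart (suc j)))
    ≡⟨ cong₂ _+_ (R-block-end j) (trans (t-block-lead (suc j)) (cong lead c)) ⟩
  suc (suc (triple j)) + 3                              ≡⟨ +-comm (suc (suc (triple j))) 3 ⟩
  suc (suc (triple (suc j)))                            ∎
  where open ≡-Reasoning

R-marked : ∀ k → 2 ≤ k → 1 ≤ R k × χ (R k) ≡ true
R-marked k 2≤k with block-of k
... | zero , _ , k<2 = ⊥-elim (<-irrefl refl (≤-trans k<2 2≤k))
... | suc j , start≤k , k<end with position-in-block (suc j) k start≤k k<end
...   | inj₁ refl rewrite R-block-end j = s≤s z≤n , χ-rem2 j
...   | inj₂ (refl , c) rewrite R-block-second j c = s≤s z≤n , trans (χ-rem0 (suc j)) c

R-onto-marked : ∀ n → 1 ≤ n → χ n ≡ true → ∃ λ k → 1 ≤ k × R k ≡ n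
R-onto-marked n 1≤n c with mod3 n
... | rem2 q = blockStart (suc q) , ≤-trans (s≤s z≤n) (2≤blockStart q) , R-block-end q
... | rem1 q = ⊥-elim (true≢false (trans (sym c) (χ-rem1 q)))
... | rem0 zero with 1≤n
...   | ()
R-onto-marked n 1≤n c | rem0 (suc q) =
  suc (blockStart (suc q)) , s≤s z≤n , R-block-second q (trans (sym (χ-rem0 (suc q))) c)

R-enumerates-records : ∀ n → (IsRecordPos n → Σ ℕ (λ k → (1 ≤ k) × (R k ≡ n))) ×
                             (Σ ℕ (λ k → (1 ≤ k) × (R k ≡ n)) → IsRecordPos n)
R-enumerates-records n = from-record , to-record
  where
    from-record : IsRecordPos n → Σ ℕ (λ k → (1 ≤ k) × (R k ≡ n))
    from-record rec with record-marked-only rec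
    ... | inj₁ refl = 1 , s≤s z≤n , refl
    ... | inj₂ c = R-onto-marked n (proj₁ rec) c
    to-record : Σ ℕ (λ k → (1 ≤ k) × (R k ≡ n)) → IsRecordPos n
    to-record (suc zero , _ , refl) = record-1
    to-record (suc (suc k) , _ , refl) =
      let (1≤Rk , c) = R-marked (suc (suc k)) (s≤s (s≤s z≤n)) in record-marked 1≤Rk c

-- Record values are Π_odd(R k) = 2 R(k) for k ≥ 2, so consecutive gaps double.
record-value : ∀ k v → 2 ≤ k → PiOdd (R k) v → v ≡ double (R k)
record-value k v 2≤k = PiOdd-marked-value (proj₁ (R-marked k 2≤k)) (proj₂ (R-marked k 2≤k))

R-gaps : ∀ n → 1 ≤ n →
  (R (n + 2) ≡ R (n + 1) + t (n + 2)) ×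
  (∀ v₁ v₂ → PiOdd (R (n + 1)) v₁ → PiOdd (R (n + 2)) v₂ → v₂ ≡ v₁ + 2 * t (n + 2))
R-gaps (suc n) _ rewrite +-comm n 2 | +-comm n 1 = refl , λ v₁ v₂ p₁ p₂ → begin
  v₂                                        ≡⟨ record-value (3 + n) v₂ (s≤s (s≤s z≤n)) p₂ ⟩
  double (R (2 + n) + t (3 + n))            ≡⟨ double-+ (R (2 + n)) (t (3 + n)) ⟩
  double (R (2 + n)) + 2 * t (3 + n)
    ≡⟨ cong (_+ 2 * t (3 + n)) (sym (record-value (2 + n) v₁ (s≤s (s≤s z≤n)) p₁)) ⟩
  v₁ + 2 * t (3 + n)                        ∎
  where open ≡-Reasoning

proposition4 : Σ (ℕ → ℕ) (λ R → IsRecordEnum R ×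
    (∀ n → 1 ≤ n →
      (R (n + 2) ≡ R (n + 1) + t (n + 2)) ×
      (∀ v₁ v₂ → PiOdd (R (n + 1)) v₁ → PiOdd (R (n + 2)) v₂ →
        v₂ ≡ v₁ + 2 * t (n + 2))))
proposition4 = R , (R-increasing , R-enumerates-records) , R-gaps
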